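{- Let $G$ be a split graph with a partition $C,I$ of its vertices, where $C$ is a clique and $I$ is an independent set. Suppose there are no vertices $x,y\in I$ such that $|N(x)\setminus N(y)|\ge 2$ and $|N(y)\setminus N(x)|\ge 2$. Let $I_0$ be the set of vertices of $I$ of minimum degree (i.e., $x\in I_0$ iff $|N(x)|\le|N(y)|$ for all $y\in I$). Let $u_1,u_2\in I_0$ be non-twin vertices; then $N(u_1)\setminus N(u_2)=\{a_1\}$ and $N(u_2)\setminus N(u_1)=\{a_2\}$ for some vertices $a_1,a_2$. Let $I_1=I_0\setminus(\mathrm{tw}(u_1)\cup \mathrm{tw}(u_2))$. If $I_1\neq\emptyset$ then either (1) for every $u\in I_1$, $N(u)$ consists of $N(u_1)\cap N(u_2)$ plus one additional vertex that is not in $\{a_1,a_2\}$, or (2) for every $u\in I_1$, $N(u)$ consists of $a_1$, $a_2$, and all the vertices of $N(u_1)\cap N(u_2)$ except one vertex.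
   Context: $N(v)$ denotes the set of vertices adjacent to $v$ in $G$. Two vertices $x,y\in I$ are twins if $N(x)=N(y)$. For $v\in I$, $\mathrm{tw}(v)$ denotes the set consisting of $v$ and all twins of $v$ in $I$. A split graph is a graph whose vertex set can be partitioned into a clique and an independent set. -}

module Defs where

open import Data.Nat using (ℕ; _≤_; _≥_)
open import Data.Bool using (Bool; true; false)
open import Data.Fin using (Fin)
open import Data.Fin.Subset using (Subset; _∈_; _∉_; _∩_; _∪_; _─_; _-_; ⁅_⁆; ∣_∣)
open import Data.Vec using (tabulate)
open import Data.Product using (Σ; ∃; ∃-syntax; _×_)
open import Data.Sum using (_⊎_)
open import Relation.Nullary using (¬_)
open import Relation.Binary.PropositionalEquality using (_≡_; _≢_)

record Graph (n : ℕ) : Set where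
  field
    adj    : Fin n → Fin n → Bool
    sym    : ∀ x y → adj x y ≡ adj y x
    irrefl : ∀ x → adj x x ≡ false
open Graph public

module _ {n : ℕ} (G : Graph n) where

  N : Fin n → Subset n
  N v = tabulate (λ w → adj G v w)

  IsSplitPartition : Subset n → Subset n → Set
  IsSplitPartition C I =
    (∀ v → (v ∈ C ⊎ v ∈ I)) ×
    (∀ v → v ∈ C → v ∉ I) ×
    (∀ x y → x ∈ C → y ∈ C → x ≢ y → adj G x y ≡ true) ×
    (∀ x y → x ∈ I → y ∈ I → adj G x y ≡ false)

  NoCrossingPair : Subset n → Set
  NoCrossingPair I = ∀ x y → x ∈ I → y ∈ I →
    ¬ (∣ N x ─ N y ∣ ≥ 2 × ∣ N y ─ N x ∣ ≥ 2)

  InI₀ : Subset n → Fin n → Set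
  InI₀ I x = x ∈ I × (∀ y → y ∈ I → ∣ N x ∣ ≤ ∣ N y ∣)

  InTw : Subset n → Fin n → Fin n → Set
  InTw I v w = w ∈ I × N w ≡ N v

  InI₁ : Subset n → Fin n → Fin n → Fin n → Set
  InI₁ I u₁ u₂ u = InI₀ I u × ¬ InTw I u₁ u × ¬ InTw I u₂ u

  Alt1 : Subset n → Fin n → Fin n → Fin n → Fin n → Set
  Alt1 I u₁ u₂ a₁ a₂ = ∀ u → InI₁ I u₁ u₂ u →
    ∃[ b ] (b ∉ (N u₁ ∩ N u₂) × b ≢ a₁ × b ≢ a₂ ×
            N u ≡ (N u₁ ∩ N u₂) ∪ ⁅ b ⁆)

  Alt2 : Subset n → Fin n → Fin n → Fin n → Fin n → Set
  Alt2 I u₁ u₂ a₁ a₂ = ∀ u → InI₁ I u₁ u₂ u →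
    ∃[ c ] (c ∈ (N u₁ ∩ N u₂) ×
            N u ≡ (⁅ a₁ ⁆ ∪ ⁅ a₂ ⁆) ∪ ((N u₁ ∩ N u₂) - c))

-- Vertices of I₀ all have the same degree, so by the no-crossing hypothesis two
-- non-twins of I₀ differ by exactly one vertex on each side.  With K = N(u₁) ∩ N(u₂)
-- we get N(u₁) = K ∪ {a₁} and N(u₂) = K ∪ {a₂}, and a neighbourhood obtained from
-- N(u₁) by one exchange x ↦ y is either K ∪ {y} (if x = a₁), or, if x ∈ K, the
-- one-exchange condition towards N(u₂) forces y = a₂ and it is {a₁, a₂} ∪ (K - x).
-- A set of the first shape and one of the second differ by {b, c} one way and by
-- {a₁, a₂} the other way, which is a crossing pair; so all of I₁ has the same shape.
module Submission where

open import Defs hiding (sym)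
open import Data.Nat using (ℕ; zero; suc; _+_; _≤_; _<_; _≥_; z≤n; s≤s)
open import Data.Nat.Properties using (+-suc; +-cancelˡ-≡; ≤-antisym; ≤-<-trans; <-irrefl)
open import Data.Fin using (Fin; _≟_)
open import Data.Fin.Subset
  using (Subset; inside; outside; _∈_; _∉_; _∩_; _∪_; _─_; _-_; ⁅_⁆; ∣_∣; ⊥)
open import Data.Fin.Subset.Properties
  using ( _∈?_; drop-there; Empty-unique; nonempty?; ∣⊥∣≡0; ⊆-antisym
        ; x∈⁅x⁆; x∈⁅y⁆⇒x≡y; x≢y⇒x∉⁅y⁆; ∩-comm; ∪-assoc; ∪-comm
        ; p∩q⊆p; p∩q⊆q; x∈p∩q⁺; p⊆p∪q; q⊆p∪q; x∈p∪q⁻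
        ; p─q⊆p; x∈p∧x∉q⇒x∈p─q; x∈p∧x≢y⇒x∈p-y; x∈p⇒∣p-x∣<∣p∣)
open import Data.Vec using ([]; _∷_; here; there)
open import Data.Product using (∃-syntax; _×_; _,_; proj₁)
open import Data.Sum using (_⊎_; inj₁; inj₂; [_,_])
open import Relation.Nullary using (¬_; yes; no; contradiction)
open import Relation.Binary.PropositionalEquality
  using (_≡_; _≢_; refl; sym; trans; cong; cong₂; subst; module ≡-Reasoning)
open import Function using (_∘_; id)
open import Level using (Level)

private
  variable
    ℓ ℓ′ : Level
    n : ℕ
    p q : Subset n
    x y : Fin n

x∈p─q⇒x∉q : ∀ (p q : Subset n) → x ∈ p ─ q → x ∉ q
x∈p─q⇒x∉q (s ∷ p) (outside ∷ q) here ()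
x∈p─q⇒x∉q (s ∷ p) (t ∷ q) (there x∈p─q) = x∈p─q⇒x∉q p q x∈p─q ∘ drop-there

p─[p─q]≡p∩q : ∀ (p q : Subset n) → p ─ (p ─ q) ≡ p ∩ q
p─[p─q]≡p∩q []            []            = refl
p─[p─q]≡p∩q (inside  ∷ p) (inside  ∷ q) = cong (inside  ∷_) (p─[p─q]≡p∩q p q)
p─[p─q]≡p∩q (inside  ∷ p) (outside ∷ q) = cong (outside ∷_) (p─[p─q]≡p∩q p q)
p─[p─q]≡p∩q (outside ∷ p) (inside  ∷ q) = cong (outside ∷_) (p─[p─q]≡p∩q p q)
p─[p─q]≡p∩q (outside ∷ p) (outside ∷ q) = cong (outside ∷_) (p─[p─q]≡p∩q p q)

p∩q∪[q─p]≡q : ∀ (p q : Subset n) → p ∩ q ∪ (q ─ p) ≡ q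
p∩q∪[q─p]≡q []            []            = refl
p∩q∪[q─p]≡q (inside  ∷ p) (inside  ∷ q) = cong (inside  ∷_) (p∩q∪[q─p]≡q p q)
p∩q∪[q─p]≡q (inside  ∷ p) (outside ∷ q) = cong (outside ∷_) (p∩q∪[q─p]≡q p q)
p∩q∪[q─p]≡q (outside ∷ p) (t       ∷ q) = cong (t ∷_) (p∩q∪[q─p]≡q p q)

∪-distribʳ-─ : ∀ (p q r : Subset n) → (p ∪ q) ─ r ≡ (p ─ r) ∪ (q ─ r)
∪-distribʳ-─ []      []      []            = refl
∪-distribʳ-─ (s ∷ p) (t ∷ q) (inside  ∷ r) = cong (outside ∷_) (∪-distribʳ-─ p q r)
∪-distribʳ-─ (s ∷ p) (t ∷ q) (outside ∷ r) = cong (_ ∷_) (∪-distribʳ-─ p q r)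

∣p∣≡∣p∩q∣+∣p─q∣ : ∀ (p q : Subset n) → ∣ p ∣ ≡ ∣ p ∩ q ∣ + ∣ p ─ q ∣
∣p∣≡∣p∩q∣+∣p─q∣ []            []            = refl
∣p∣≡∣p∩q∣+∣p─q∣ (inside  ∷ p) (inside  ∷ q) = cong suc (∣p∣≡∣p∩q∣+∣p─q∣ p q)
∣p∣≡∣p∩q∣+∣p─q∣ (inside  ∷ p) (outside ∷ q) =
  trans (cong suc (∣p∣≡∣p∩q∣+∣p─q∣ p q)) (sym (+-suc _ _))
∣p∣≡∣p∩q∣+∣p─q∣ (outside ∷ p) (inside  ∷ q) = ∣p∣≡∣p∩q∣+∣p─q∣ p q
∣p∣≡∣p∩q∣+∣p─q∣ (outside ∷ p) (outside ∷ q) = ∣p∣≡∣p∩q∣+∣p─q∣ p q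

∣p─q∣≡∣q─p∣ : ∀ (p q : Subset n) → ∣ p ∣ ≡ ∣ q ∣ → ∣ p ─ q ∣ ≡ ∣ q ─ p ∣
∣p─q∣≡∣q─p∣ p q |p|≡|q| = +-cancelˡ-≡ ∣ p ∩ q ∣ _ _ (begin
  ∣ p ∩ q ∣ + ∣ p ─ q ∣  ≡⟨ sym (∣p∣≡∣p∩q∣+∣p─q∣ p q) ⟩
  ∣ p ∣                  ≡⟨ |p|≡|q| ⟩
  ∣ q ∣                  ≡⟨ ∣p∣≡∣p∩q∣+∣p─q∣ q p ⟩
  ∣ q ∩ p ∣ + ∣ q ─ p ∣  ≡⟨ cong (λ s → ∣ s ∣ + ∣ q ─ p ∣) (∩-comm q p) ⟩
  ∣ p ∩ q ∣ + ∣ q ─ p ∣  ∎)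
  where open ≡-Reasoning

x∈p⇒0<∣p∣ : x ∈ p → 0 < ∣ p ∣
x∈p⇒0<∣p∣ x∈p = ≤-<-trans z≤n (x∈p⇒∣p-x∣<∣p∣ x∈p)

x∈p⇒y∈p⇒x≢y⇒1<∣p∣ : x ∈ p → y ∈ p → x ≢ y → 1 < ∣ p ∣
x∈p⇒y∈p⇒x≢y⇒1<∣p∣ x∈p y∈p x≢y =
  ≤-<-trans (x∈p⇒0<∣p∣ (x∈p∧x≢y⇒x∈p-y y∈p (x≢y ∘ sym))) (x∈p⇒∣p-x∣<∣p∣ x∈p)

∣p∣≡0⇒p≡⊥ : ∣ p ∣ ≡ 0 → p ≡ ⊥
∣p∣≡0⇒p≡⊥ |p|≡0 = Empty-unique λ (_ , x∈p) → <-irrefl (sym |p|≡0) (x∈p⇒0<∣p∣ x∈p)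

∣p∣≡1⇒p≡⁅x⁆ : ∀ {n} (p : Subset n) → ∣ p ∣ ≡ 1 → ∃[ x ] p ≡ ⁅ x ⁆
∣p∣≡1⇒p≡⁅x⁆ {n} p |p|≡1 with nonempty? p
... | no p-empty =
  contradiction (trans (sym (∣⊥∣≡0 n)) (subst (λ s → ∣ s ∣ ≡ 1) (Empty-unique p-empty) |p|≡1)) λ ()
... | yes (x , x∈p) = x , ⊆-antisym p⊆⁅x⁆ ⁅x⁆⊆p
  where
  p⊆⁅x⁆ : ∀ {y} → y ∈ p → y ∈ ⁅ x ⁆
  p⊆⁅x⁆ {y} y∈p with y ≟ x
  ... | yes refl = x∈⁅x⁆ x
  ... | no y≢x   = contradiction (subst (1 <_) |p|≡1 (x∈p⇒y∈p⇒x≢y⇒1<∣p∣ y∈p x∈p y≢x)) (<-irrefl refl)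
  ⁅x⁆⊆p : ∀ {y} → y ∈ ⁅ x ⁆ → y ∈ p
  ⁅x⁆⊆p y∈⁅x⁆ = subst (_∈ p) (sym (x∈⁅y⁆⇒x≡y x y∈⁅x⁆)) x∈p

p─q≡p─r⇒p∩q≡p∩r : ∀ (p q r : Subset n) → p ─ q ≡ p ─ r → p ∩ q ≡ p ∩ r
p─q≡p─r⇒p∩q≡p∩r p q r p─q≡p─r = begin
  p ∩ q        ≡⟨ sym (p─[p─q]≡p∩q p q) ⟩
  p ─ (p ─ q)  ≡⟨ cong (p ─_) p─q≡p─r ⟩
  p ─ (p ─ r)  ≡⟨ p─[p─q]≡p∩q p r ⟩
  p ∩ r        ∎
  where open ≡-Reasoning

differences-determine : ∀ (p q r : Subset n) → p ─ q ≡ p ─ r → q ─ p ≡ r ─ p → q ≡ r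
differences-determine p q r p─q≡p─r q─p≡r─p = begin
  q                ≡⟨ sym (p∩q∪[q─p]≡q p q) ⟩
  p ∩ q ∪ (q ─ p)  ≡⟨ cong₂ _∪_ (p─q≡p─r⇒p∩q≡p∩r p q r p─q≡p─r) q─p≡r─p ⟩
  p ∩ r ∪ (r ─ p)  ≡⟨ p∩q∪[q─p]≡q p r ⟩
  r                ∎
  where open ≡-Reasoning

p─q≡⊥⇒q─p≡⊥⇒p≡q : ∀ (p q : Subset n) → p ─ q ≡ ⊥ → q ─ p ≡ ⊥ → p ≡ q
p─q≡⊥⇒q─p≡⊥⇒p≡q p q p─q≡⊥ q─p≡⊥ = begin
  p                ≡⟨ sym (p∩q∪[q─p]≡q q p) ⟩
  q ∩ p ∪ (p ─ q)  ≡⟨ cong₂ _∪_ (∩-comm q p) (trans p─q≡⊥ (sym q─p≡⊥)) ⟩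
  p ∩ q ∪ (q ─ p)  ≡⟨ p∩q∪[q─p]≡q p q ⟩
  q                ∎
  where open ≡-Reasoning

module SoleDifference {n} {p q : Subset n} {a : Fin n} (p─q≡⁅a⁆ : p ─ q ≡ ⁅ a ⁆) where

  a∈p─q : a ∈ p ─ q
  a∈p─q = subst (a ∈_) (sym p─q≡⁅a⁆) (x∈⁅x⁆ a)

  a∈p : a ∈ p
  a∈p = p─q⊆p p q a∈p─q

  a∉q : a ∉ q
  a∉q = x∈p─q⇒x∉q p q a∈p─q

  unique : x ∈ p → x ∉ q → x ≡ a
  unique {x} x∈p x∉q = x∈⁅y⁆⇒x≡y a (subst (x ∈_) p─q≡⁅a⁆ (x∈p∧x∉q⇒x∈p─q x∈p x∉q))

  ∈q : x ∈ p → x ≢ a → x ∈ q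
  ∈q {x} x∈p x≢a with x ∈? q
  ... | yes x∈q = x∈q
  ... | no  x∉q = contradiction (unique x∈p x∉q) x≢a

singleton-differences : ∀ (p q : Subset n) → ∣ p ∣ ≡ ∣ q ∣ → p ≢ q →
  ¬ (∣ p ─ q ∣ ≥ 2 × ∣ q ─ p ∣ ≥ 2) →
  ∃[ a ] ∃[ b ] (p ─ q ≡ ⁅ a ⁆ × q ─ p ≡ ⁅ b ⁆)
singleton-differences p q |p|≡|q| p≢q ¬both
  with ∣ p ─ q ∣ in |p─q|≡k | ∣p─q∣≡∣q─p∣ p q |p|≡|q|
... | 0 | 0≡|q─p| =
  contradiction (p─q≡⊥⇒q─p≡⊥⇒p≡q p q (∣p∣≡0⇒p≡⊥ |p─q|≡k) (∣p∣≡0⇒p≡⊥ (sym 0≡|q─p|))) p≢q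
... | 1 | 1≡|q─p|
  with a , p─q≡⁅a⁆ ← ∣p∣≡1⇒p≡⁅x⁆ (p ─ q) |p─q|≡k
     | b , q─p≡⁅b⁆ ← ∣p∣≡1⇒p≡⁅x⁆ (q ─ p) (sym 1≡|q─p|) = a , b , p─q≡⁅a⁆ , q─p≡⁅b⁆
... | suc (suc k) | k+2≡|q─p| =
  contradiction (2≤k+2 , subst (2 ≤_) k+2≡|q─p| 2≤k+2) ¬both
  where
  2≤k+2 : 2 ≤ suc (suc k)
  2≤k+2 = s≤s (s≤s z≤n)

x∉p⇒x∉q⇒x∉p∪q : x ∉ p → x ∉ q → x ∉ p ∪ q
x∉p⇒x∉q⇒x∉p∪q {p = p} {q = q} x∉p x∉q = [ x∉p , x∉q ] ∘ x∈p∪q⁻ p q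

x≢y⇒⁅x⁆-y≡⁅x⁆ : x ≢ y → ⁅ x ⁆ - y ≡ ⁅ x ⁆
x≢y⇒⁅x⁆-y≡⁅x⁆ {x = x} {y = y} x≢y = ⊆-antisym (p─q⊆p ⁅ x ⁆ ⁅ y ⁆) ⁅x⁆⊆⁅x⁆-y
  where
  ⁅x⁆⊆⁅x⁆-y : ∀ {z} → z ∈ ⁅ x ⁆ → z ∈ ⁅ x ⁆ - y
  ⁅x⁆⊆⁅x⁆-y z∈⁅x⁆ = x∈p∧x≢y⇒x∈p-y z∈⁅x⁆ (x≢y ∘ trans (sym (x∈⁅y⁆⇒x≡y x z∈⁅x⁆)))

CorePlusOne : (p q : Subset n) (a₁ a₂ : Fin n) → Subset n → Set
CorePlusOne p q a₁ a₂ r = ∃[ b ] (b ∉ p ∩ q × b ≢ a₁ × b ≢ a₂ × r ≡ (p ∩ q) ∪ ⁅ b ⁆)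

CoreMinusOne : (p q : Subset n) (a₁ a₂ : Fin n) → Subset n → Set
CoreMinusOne p q a₁ a₂ r = ∃[ c ] (c ∈ p ∩ q × r ≡ (⁅ a₁ ⁆ ∪ ⁅ a₂ ⁆) ∪ ((p ∩ q) - c))

module _ {n} {p q : Subset n} {a₁ a₂ : Fin n}
         (p─q≡⁅a₁⁆ : p ─ q ≡ ⁅ a₁ ⁆) (q─p≡⁅a₂⁆ : q ─ p ≡ ⁅ a₂ ⁆) where

  private
    module P─Q = SoleDifference p─q≡⁅a₁⁆
    module Q─P = SoleDifference q─p≡⁅a₂⁆
    open ≡-Reasoning

  p≡p∩q∪⁅a₁⁆ : p ≡ (p ∩ q) ∪ ⁅ a₁ ⁆
  p≡p∩q∪⁅a₁⁆ = begin
    p                ≡⟨ sym (p∩q∪[q─p]≡q q p) ⟩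
    q ∩ p ∪ (p ─ q)  ≡⟨ cong₂ _∪_ (∩-comm q p) p─q≡⁅a₁⁆ ⟩
    p ∩ q ∪ ⁅ a₁ ⁆   ∎

  corePlusOne⊎coreMinusOne : ∀ {r x y z} →
    p ─ r ≡ ⁅ x ⁆ → r ─ p ≡ ⁅ y ⁆ → r ─ q ≡ ⁅ z ⁆ → r ≢ q →
    CorePlusOne p q a₁ a₂ r ⊎ CoreMinusOne p q a₁ a₂ r
  corePlusOne⊎coreMinusOne {r} {x} {y} {z} p─r≡⁅x⁆ r─p≡⁅y⁆ r─q≡⁅z⁆ r≢q with x ≟ a₁
  ... | yes refl = inj₁ (y , y∉p ∘ p∩q⊆p p q , y≢a₁ , y≢a₂ , r≡p∩q∪⁅y⁆)
    where
    p─r≡p─q : p ─ r ≡ p ─ q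
    p─r≡p─q = trans p─r≡⁅x⁆ (sym p─q≡⁅a₁⁆)
    y∉p : y ∉ p
    y∉p = SoleDifference.a∉q r─p≡⁅y⁆
    y≢a₁ : y ≢ a₁
    y≢a₁ refl = y∉p P─Q.a∈p
    y≢a₂ : y ≢ a₂
    y≢a₂ refl = r≢q (differences-determine p r q p─r≡p─q (trans r─p≡⁅y⁆ (sym q─p≡⁅a₂⁆)))
    r≡p∩q∪⁅y⁆ : r ≡ (p ∩ q) ∪ ⁅ y ⁆
    r≡p∩q∪⁅y⁆ = begin
      r                ≡⟨ sym (p∩q∪[q─p]≡q p r) ⟩
      p ∩ r ∪ (r ─ p)  ≡⟨ cong₂ _∪_ (p─q≡p─r⇒p∩q≡p∩r p r q p─r≡p─q) r─p≡⁅y⁆ ⟩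
      p ∩ q ∪ ⁅ y ⁆    ∎
  ... | no x≢a₁ = inj₂ (x , x∈p∩q⁺ (P─R.a∈p , P─Q.∈q P─R.a∈p x≢a₁) , r≡⁅a₁⁆∪⁅a₂⁆∪p∩q-x)
    where
    module P─R = SoleDifference p─r≡⁅x⁆
    module R─P = SoleDifference r─p≡⁅y⁆
    module R─Q = SoleDifference r─q≡⁅z⁆
    a₁≡z : a₁ ≡ z
    a₁≡z = R─Q.unique (P─R.∈q P─Q.a∈p (x≢a₁ ∘ sym)) P─Q.a∉q
    y≢z : y ≢ z
    y≢z y≡z = R─P.a∉q (subst (_∈ p) (trans a₁≡z (sym y≡z)) P─Q.a∈p)
    y≡a₂ : y ≡ a₂
    y≡a₂ = Q─P.unique (R─Q.∈q R─P.a∈p y≢z) R─P.a∉q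
    r≡⁅a₁⁆∪⁅a₂⁆∪p∩q-x : r ≡ (⁅ a₁ ⁆ ∪ ⁅ a₂ ⁆) ∪ ((p ∩ q) - x)
    r≡⁅a₁⁆∪⁅a₂⁆∪p∩q-x = begin
      r                                      ≡⟨ sym (p∩q∪[q─p]≡q p r) ⟩
      p ∩ r ∪ (r ─ p)                        ≡⟨ cong₂ _∪_ (sym (p─[p─q]≡p∩q p r)) r─p≡⁅y⁆ ⟩
      (p ─ (p ─ r)) ∪ ⁅ y ⁆                  ≡⟨ cong₂ (λ s t → (p ─ s) ∪ ⁅ t ⁆) p─r≡⁅x⁆ y≡a₂ ⟩
      (p - x) ∪ ⁅ a₂ ⁆                       ≡⟨ cong (λ s → (s - x) ∪ ⁅ a₂ ⁆) p≡p∩q∪⁅a₁⁆ ⟩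
      ((p ∩ q ∪ ⁅ a₁ ⁆) - x) ∪ ⁅ a₂ ⁆        ≡⟨ cong (_∪ ⁅ a₂ ⁆) (∪-distribʳ-─ (p ∩ q) ⁅ a₁ ⁆ ⁅ x ⁆) ⟩
      ((p ∩ q - x) ∪ (⁅ a₁ ⁆ - x)) ∪ ⁅ a₂ ⁆  ≡⟨ cong (λ s → ((p ∩ q - x) ∪ s) ∪ ⁅ a₂ ⁆) (x≢y⇒⁅x⁆-y≡⁅x⁆ (x≢a₁ ∘ sym)) ⟩
      ((p ∩ q - x) ∪ ⁅ a₁ ⁆) ∪ ⁅ a₂ ⁆        ≡⟨ ∪-assoc (p ∩ q - x) ⁅ a₁ ⁆ ⁅ a₂ ⁆ ⟩
      (p ∩ q - x) ∪ (⁅ a₁ ⁆ ∪ ⁅ a₂ ⁆)        ≡⟨ ∪-comm (p ∩ q - x) (⁅ a₁ ⁆ ∪ ⁅ a₂ ⁆) ⟩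
      (⁅ a₁ ⁆ ∪ ⁅ a₂ ⁆) ∪ (p ∩ q - x)        ∎

  corePlusOne-coreMinusOne-cross : ∀ {r s} →
    CorePlusOne p q a₁ a₂ r → CoreMinusOne p q a₁ a₂ s → ∣ r ─ s ∣ ≥ 2 × ∣ s ─ r ∣ ≥ 2
  corePlusOne-coreMinusOne-cross (b , b∉p∩q , b≢a₁ , b≢a₂ , refl) (c , c∈p∩q , refl) =
    x∈p⇒y∈p⇒x≢y⇒1<∣p∣ (x∈p∧x∉q⇒x∈p─q b∈r b∉s) (x∈p∧x∉q⇒x∈p─q c∈r c∉s) b≢c ,
    x∈p⇒y∈p⇒x≢y⇒1<∣p∣ (x∈p∧x∉q⇒x∈p─q a₁∈s a₁∉r) (x∈p∧x∉q⇒x∈p─q a₂∈s a₂∉r) a₁≢a₂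
    where
    r s : Subset n
    r = (p ∩ q) ∪ ⁅ b ⁆
    s = (⁅ a₁ ⁆ ∪ ⁅ a₂ ⁆) ∪ ((p ∩ q) - c)
    b∈r : b ∈ r
    b∈r = q⊆p∪q (p ∩ q) ⁅ b ⁆ (x∈⁅x⁆ b)
    c∈r : c ∈ r
    c∈r = p⊆p∪q ⁅ b ⁆ c∈p∩q
    a₁∈s : a₁ ∈ s
    a₁∈s = p⊆p∪q (p ∩ q - c) (p⊆p∪q ⁅ a₂ ⁆ (x∈⁅x⁆ a₁))
    a₂∈s : a₂ ∈ s
    a₂∈s = p⊆p∪q (p ∩ q - c) (q⊆p∪q ⁅ a₁ ⁆ ⁅ a₂ ⁆ (x∈⁅x⁆ a₂))
    b∉s : b ∉ s
    b∉s = x∉p⇒x∉q⇒x∉p∪q (x∉p⇒x∉q⇒x∉p∪q (x≢y⇒x∉⁅y⁆ b≢a₁) (x≢y⇒x∉⁅y⁆ b≢a₂)) (b∉p∩q ∘ p─q⊆p (p ∩ q) ⁅ c ⁆)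
    c≢a₁ : c ≢ a₁
    c≢a₁ refl = P─Q.a∉q (p∩q⊆q p q c∈p∩q)
    c≢a₂ : c ≢ a₂
    c≢a₂ refl = Q─P.a∉q (p∩q⊆p p q c∈p∩q)
    c∉s : c ∉ s
    c∉s = x∉p⇒x∉q⇒x∉p∪q (x∉p⇒x∉q⇒x∉p∪q (x≢y⇒x∉⁅y⁆ c≢a₁) (x≢y⇒x∉⁅y⁆ c≢a₂))
                          (λ c∈p∩q-c → x∈p─q⇒x∉q (p ∩ q) ⁅ c ⁆ c∈p∩q-c (x∈⁅x⁆ c))
    a₁∉r : a₁ ∉ r
    a₁∉r = x∉p⇒x∉q⇒x∉p∪q (P─Q.a∉q ∘ p∩q⊆q p q) (x≢y⇒x∉⁅y⁆ (b≢a₁ ∘ sym))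
    a₂∉r : a₂ ∉ r
    a₂∉r = x∉p⇒x∉q⇒x∉p∪q (Q─P.a∉q ∘ p∩q⊆p p q) (x≢y⇒x∉⁅y⁆ (b≢a₂ ∘ sym))
    b≢c : b ≢ c
    b≢c refl = b∉p∩q c∈p∩q
    a₁≢a₂ : a₁ ≢ a₂
    a₁≢a₂ refl = Q─P.a∉q P─Q.a∈p

uniform-dichotomy : {A : Set ℓ} {S P Q : A → Set ℓ′} →
  (∀ u → S u → P u ⊎ Q u) → (∀ u v → S u → S v → P u → ¬ Q v) →
  ∃[ u ] S u → (∀ u → S u → P u) ⊎ (∀ u → S u → Q u)
uniform-dichotomy classify incompatible (u₀ , S-u₀) with classify u₀ S-u₀
... | inj₁ P-u₀ = inj₁ λ u S-u →
  [ id , (λ Q-u → contradiction Q-u (incompatible u₀ u S-u₀ S-u P-u₀)) ] (classify u S-u)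
... | inj₂ Q-u₀ = inj₂ λ u S-u →
  [ (λ P-u → contradiction Q-u₀ (incompatible u u₀ S-u S-u₀ P-u)) , id ] (classify u S-u)

module _ {n} (G : Graph n) (I : Subset n) (noCrossing : NoCrossingPair G I) where

  I₀-singleton-differences : ∀ {u v} → InI₀ G I u → InI₀ G I v → N G u ≢ N G v →
    ∃[ a ] ∃[ b ] (N G u ─ N G v ≡ ⁅ a ⁆ × N G v ─ N G u ≡ ⁅ b ⁆)
  I₀-singleton-differences {u} {v} (u∈I , u-min) (v∈I , v-min) Nu≢Nv =
    singleton-differences (N G u) (N G v) (≤-antisym (u-min v v∈I) (v-min u u∈I)) Nu≢Nv
      (noCrossing u v u∈I v∈I)

  I₁-dichotomy : ∀ {u₁ u₂ a₁ a₂} → InI₀ G I u₁ → InI₀ G I u₂ →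
    (N₁─N₂ : N G u₁ ─ N G u₂ ≡ ⁅ a₁ ⁆) (N₂─N₁ : N G u₂ ─ N G u₁ ≡ ⁅ a₂ ⁆) →
    ∃[ u ] InI₁ G I u₁ u₂ u → Alt1 G I u₁ u₂ a₁ a₂ ⊎ Alt2 G I u₁ u₂ a₁ a₂
  I₁-dichotomy {u₁} {u₂} {a₁} {a₂} u₁∈I₀ u₂∈I₀ N₁─N₂ N₂─N₁ = uniform-dichotomy shape incompatible
    where
    shape : ∀ u → InI₁ G I u₁ u₂ u →
      CorePlusOne (N G u₁) (N G u₂) a₁ a₂ (N G u) ⊎ CoreMinusOne (N G u₁) (N G u₂) a₁ a₂ (N G u)
    shape u (u∈I₀ , ¬twin₁ , ¬twin₂)
      with _ , _ , N₁─N , N─N₁ ← I₀-singleton-differences u₁∈I₀ u∈I₀ (λ N₁≡N → ¬twin₁ (proj₁ u∈I₀ , sym N₁≡N))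
         | _ , _ , _   , N─N₂ ← I₀-singleton-differences u₂∈I₀ u∈I₀ (λ N₂≡N → ¬twin₂ (proj₁ u∈I₀ , sym N₂≡N))
      = corePlusOne⊎coreMinusOne N₁─N₂ N₂─N₁ N₁─N N─N₁ N─N₂ (λ N≡N₂ → ¬twin₂ (proj₁ u∈I₀ , N≡N₂))
    incompatible : ∀ u v → InI₁ G I u₁ u₂ u → InI₁ G I u₁ u₂ v →
      CorePlusOne (N G u₁) (N G u₂) a₁ a₂ (N G u) → ¬ CoreMinusOne (N G u₁) (N G u₂) a₁ a₂ (N G v)
    incompatible u v ((u∈I , _) , _) ((v∈I , _) , _) plus minus =
      noCrossing u v u∈I v∈I (corePlusOne-coreMinusOne-cross N₁─N₂ N₂─N₁ plus minus)

lemma4 : {n : ℕ} (G : Graph n) (C I : Subset n) →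
    IsSplitPartition G C I →
    NoCrossingPair G I →
    (u₁ u₂ : Fin n) → InI₀ G I u₁ → InI₀ G I u₂ → N G u₁ ≢ N G u₂ →
    ∃[ a₁ ] ∃[ a₂ ] (
      N G u₁ ─ N G u₂ ≡ ⁅ a₁ ⁆ ×
      N G u₂ ─ N G u₁ ≡ ⁅ a₂ ⁆ ×
      ((∃[ u ] InI₁ G I u₁ u₂ u) →
        Alt1 G I u₁ u₂ a₁ a₂ ⊎ Alt2 G I u₁ u₂ a₁ a₂))
lemma4 G _ I _ noCrossing u₁ u₂ u₁∈I₀ u₂∈I₀ N₁≢N₂
  with a₁ , a₂ , N₁─N₂ , N₂─N₁ ← I₀-singleton-differences G I noCrossing u₁∈I₀ u₂∈I₀ N₁≢N₂
  = a₁ , a₂ , N₁─N₂ , N₂─N₁ , I₁-dichotomy G I noCrossing u₁∈I₀ u₂∈I₀ N₁─N₂ N₂─N₁
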